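{- Let $2\le k\le n-2$ and $A\subseteq[n]$. Then $D_{k,n}(A)$ is a Le-diagram.
   Context: A Le-diagram is a filling of the (left-justified, largest row on top) Young diagram of a partition, where each box is empty or contains a dot, such that for $i<i'$ and $j<j'$ (box $(i,j)$ in row $i$ from the top and column $j$ from the left), whenever box $(i',j')$ exists and both boxes $(i,j')$ and $(i',j)$ contain dots, box $(i',j')$ contains a dot. In the $k\times(n-k)$ rectangle, number $n$ boundary cells: the lower-right corner cell gets $1$; the cells of the top row, from right to left, get $2,3,\dots,n-k+1$; the cells of the leftmost column, from top to bottom, get $n-k+1,n-k+2,\dots,n$ (the top-left cell gets $n-k+1$). $D_{k,n}(A)$ is obtained from the $k\times(n-k)$ rectangle filled entirely with dots by removing the dot in the cell numbered $i$ for each $i\in A$, and, if $1\in A$, additionally removing the lower-right cell itself from the diagram. -}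

module Defs where

open import Data.Nat using (ℕ; zero; suc; _+_; _∸_; _≤_; _<_; _≡ᵇ_; _≤ᵇ_)
open import Data.Bool using (Bool; true; false; if_then_else_; _∧_)
open import Data.Fin using (Fin; toℕ)
open import Data.Fin.Subset using (Subset; _∈_)
open import Data.Vec using (Vec; []; _∷_)
open import Data.Product using (Σ; _×_; _,_)
open import Relation.Nullary using (¬_)
open import Relation.Binary.PropositionalEquality using (_≡_)

-- A diagram: a left-justified shape with `rows` rows, row r (0-indexed from
-- the top) having `rowLen r` boxes (columns 0-indexed from the left), and a
-- predicate `Dot r c` saying the box (r , c) contains a dot.
record Diagram : Set₁ where
  field
    rows   : ℕ
    rowLen : ℕ → ℕ
    Dot    : ℕ → ℕ → Set

open Diagram public

Box : Diagram → ℕ → ℕ → Set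
Box D r c = (r < rows D) × (c < rowLen D r)

IsPartitionShape : Diagram → Set
IsPartitionShape D = ∀ r r' → r ≤ r' → r' < rows D → rowLen D r' ≤ rowLen D r

LeProperty : Diagram → Set
LeProperty D = ∀ i i' j j' → i < i' → j < j' → Box D i' j' →
               Dot D i j' → Dot D i' j → Dot D i' j'

IsLeDiagram : Diagram → Set
IsLeDiagram D = IsPartitionShape D × LeProperty D

-- A ⊆ [n] is encoded as a Subset n; index i : Fin n stands for the label i+1.
_∈L_ : {n : ℕ} → ℕ → Subset n → Set
_∈L_ {n} l A = Σ (Fin n) (λ i → (suc (toℕ i) ≡ l) × (i ∈ A))

oneIn : {n : ℕ} → Subset n → Bool
oneIn []      = false
oneIn (b ∷ _) = b

-- the boundary cell (row , column), 0-indexed, carrying label l (1 ≤ l ≤ n)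
-- in the k × (n-k) rectangle
cell : ℕ → ℕ → ℕ → ℕ × ℕ
cell k n l =
  if l ≡ᵇ 1 then (k ∸ 1 , n ∸ k ∸ 1)
  else if l ≤ᵇ (n ∸ k + 1) then (0 , (n ∸ k + 1) ∸ l)
  else (l ∸ (n ∸ k + 1) , 0)

D : (k n : ℕ) → Subset n → Diagram
D k n A = record
  { rows   = k
  ; rowLen = λ r → if oneIn A ∧ (r ≡ᵇ (k ∸ 1)) then n ∸ k ∸ 1 else n ∸ k
  ; Dot    = λ r c → ¬ (Σ ℕ (λ l → (l ∈L A) × (cell k n l ≡ (r , c))))
  }

-- Every label sits in the top row or the leftmost column, except the label 1,
-- which sits in the lower-right corner.  A box (i', j') to which the
-- Le-condition applies has i' > 0 and j' > 0, so its dot can only be missing if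
-- it is that corner with 1 ∈ A; but then the corner box is not in the diagram.
-- The shape is a partition because at most the bottom row is shortened.
-- Neither argument uses the bounds on k.
module Submission where

open import Defs
open import Data.Nat using (ℕ; zero; suc; _+_; _≤_; _<_; _∸_; _≡ᵇ_; _≤ᵇ_; s≤s)
open import Data.Nat.Properties using (≡ᵇ⇒≡; ≡⇒≡ᵇ; ≤-refl; ≤-antisym; <⇒≤pred; m∸n≤m; <-irrefl)
open import Data.Bool using (Bool; true; false; T; _∧_; if_then_else_)
open import Data.Fin using (Fin)
open import Data.Fin.Subset using (Subset)
open import Data.Vec using (_∷_; here)
open import Data.Product using (_×_; _,_)
open import Data.Product.Properties using (,-injective)
open import Data.Empty using (⊥-elim)
open import Relation.Nullary using (¬_)
open import Relation.Binary.PropositionalEquality using (_≡_; refl; sym; subst; subst₂)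

≡ᵇ-refl : ∀ m → (m ≡ᵇ m) ≡ true
≡ᵇ-refl zero    = refl
≡ᵇ-refl (suc m) = ≡ᵇ-refl m

≡ᵇ-true⇒≡ : ∀ {m n} → (m ≡ᵇ n) ≡ true → m ≡ n
≡ᵇ-true⇒≡ {m} {n} e = ≡ᵇ⇒≡ m n (subst T (sym e) _)

oneIn-true : ∀ {n} {A : Subset n} → 1 ∈L A → oneIn A ≡ true
oneIn-true {A = _ ∷ _} (Fin.zero , refl , here) = refl

-- rowLen (D k n A) is definitionally shortenLastRow (oneIn A) k (n ∸ k).
shortenLastRow : Bool → ℕ → ℕ → ℕ → ℕ
shortenLastRow b k m r = if b ∧ (r ≡ᵇ k ∸ 1) then m ∸ 1 else m

shortenLastRow-lastRow : ∀ k m → shortenLastRow true k m (k ∸ 1) ≡ m ∸ 1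
shortenLastRow-lastRow k m with k ∸ 1 ≡ᵇ k ∸ 1 | ≡ᵇ-refl (k ∸ 1)
... | true | _ = refl

pred≤shortenLastRow : ∀ b k m r → m ∸ 1 ≤ shortenLastRow b k m r
pred≤shortenLastRow b k m r with b ∧ (r ≡ᵇ k ∸ 1)
... | true  = ≤-refl
... | false = m∸n≤m m 1

shortenLastRow-antitone : ∀ b k m r r' → r ≤ r' → r' < k →
                          shortenLastRow b k m r' ≤ shortenLastRow b k m r
shortenLastRow-antitone false k m r r' _ _ = ≤-refl
shortenLastRow-antitone true k m r r' r≤r' r'<k with r' ≡ᵇ k ∸ 1 in e'
... | true  = pred≤shortenLastRow true k m r
... | false with r ≡ᵇ k ∸ 1 in e
...   | false = ≤-refl
...   | true  = ⊥-elim (subst T e' (≡⇒≡ᵇ r' (k ∸ 1) r'≡k-1))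
  where
  r'≡k-1 : r' ≡ k ∸ 1
  r'≡k-1 = ≤-antisym (<⇒≤pred r'<k) (subst (_≤ r') (≡ᵇ-true⇒≡ e) r≤r')

cell-interior⇒corner : ∀ k n l {i j} → cell k n l ≡ (suc i , suc j) →
                       l ≡ 1 × k ∸ 1 ≡ suc i × n ∸ k ∸ 1 ≡ suc j
cell-interior⇒corner k n l with l ≡ᵇ 1 in e
... | true = λ cell≡ → ≡ᵇ-true⇒≡ e , ,-injective cell≡
... | false with l ≤ᵇ n ∸ k + 1
...   | true  = λ ()
...   | false = λ ()

D-corner-deleted : ∀ k n {A : Subset n} → 1 ∈L A → ¬ Box (D k n A) (k ∸ 1) (n ∸ k ∸ 1)
D-corner-deleted k n {A} 1∈A (_ , corner<rowLen)
  rewrite oneIn-true 1∈A | shortenLastRow-lastRow k (n ∸ k) = <-irrefl refl corner<rowLen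

D-le : ∀ k n (A : Subset n) → LeProperty (D k n A)
D-le k n A i (suc i') j (suc j') (s≤s _) (s≤s _) box _ _ (l , l∈A , cell≡)
  with cell-interior⇒corner k n l cell≡
... | refl , k-1≡i' , n-k-1≡j' =
  D-corner-deleted k n l∈A (subst₂ (Box (D k n A)) (sym k-1≡i') (sym n-k-1≡j') box)

mainTheorem4 : (k n : ℕ) → 2 ≤ k → k ≤ n ∸ 2 → (A : Subset n) → IsLeDiagram (D k n A)
mainTheorem4 k n _ _ A = shortenLastRow-antitone (oneIn A) k (n ∸ k) , D-le k n A
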